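{- Let $G=(V,E)$ be a connected graph and let $F\subseteq\binom{V}{2}\setminus E$, $\widehat G=(V,E\cup F)$. Then $\mathrm{LMC}(G,\widehat G)$ is the convex hull of all vectors $x\in\{0,1\}^{E\cup F}$ that satisfy (1) $x_f \le \sum_{e\in E_C\setminus\{f\}} x_e$ for every cycle $C=(V_C,E_C)$ in $G$ and every $f\in E_C$; (2) $x_{uv}\le \sum_{e\in E_P} x_e$ for every $uv\in F$ and every $uv$-path $P=(V_P,E_P)$ in $G$; (3) $1-x_{uv}\le \sum_{e\in\delta(U)}(1-x_e)$ for every $uv\in F$ and every $uv$-cut $\delta(U)$ in $G$.
   Context: Graphs are finite, simple, undirected; $uv$ denotes the pair $\{u,v\}$. A decomposition of a graph $H=(V,E_H)$ is a partition $\Pi$ of $V$ such that each block induces a connected subgraph of $H$. A $uv$-decomposition of $G$ is a decomposition $\{U,V\setminus U\}$ of $G$ into exactly two blocks with $u\in U$, $v\notin U$ (or vice versa); the induced $uv$-cut is $\delta(U)=\{ab\in E: a\in U, b\notin U\}$. For a decomposition $\Pi$ of $G$, the multicut of $\widehat G$ lifted from $G$ induced by $\Pi$ is the set of edges of $E\cup F$ whose endpoints lie in distinct blocks of $\Pi$. $\mathrm{LMC}(G,\widehat G)\subseteq\mathbb{R}^{E\cup F}$ is the convex hull of the characteristic vectors of all multicuts of $\widehat G$ lifted from $G$ (over all decompositions $\Pi$ of $G$).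
   Formalization: Both convex hulls are taken over ℚ: only points with rational coordinates, written as convex combinations with rational coefficients, are compared, rather than all points of $\mathbb{R}^{E\cup F}$. -}

module Defs where

open import Data.Nat using (ℕ; _≤_)
open import Data.Fin using (Fin; _<_; _<?_)
open import Data.Fin.Properties using (<-cmp) renaming (_≟_ to _≟ᶠ_)
open import Data.Bool using (Bool; true; false; T; T?; if_then_else_; not; _xor_)
open import Data.List using (List; []; _∷_; map; foldr; length; concatMap; allFin)
open import Data.List.Relation.Unary.All using (All)
open import Data.List.Relation.Unary.Any using (Any)
open import Data.List.Relation.Unary.Unique.Propositional using (Unique)
open import Data.Product using (Σ; _×_; _,_; proj₁; proj₂)
open import Data.Sum using (_⊎_; inj₁; inj₂)
open import Data.Empty using (⊥-elim)
open import Data.Rational using (ℚ; 0ℚ; 1ℚ; _+_; _*_; _-_) renaming (_≤_ to _≤ℚ_)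
open import Relation.Nullary using (¬_; yes; no; does)
open import Relation.Binary.PropositionalEquality using (_≡_; refl; subst)
open import Relation.Binary.Definitions using (tri<; tri≈; tri>)
open import Function using (_∘_)
open import Function.Bundles using (_⇔_)

record SimpleGraph (n : ℕ) : Set where
  field
    adj    : Fin n → Fin n → Bool
    adj-sym : ∀ u v → adj u v ≡ adj v u
    irrefl : ∀ u → adj u u ≡ false
open SimpleGraph public

sumℚ : List ℚ → ℚ
sumℚ = foldr _+_ 0ℚ

module _ {n : ℕ} (G : SimpleGraph n) (F : Fin n → Fin n → Bool) where

  -- Edge set E ∪ F of Ĝ, each pair uv listed once as (a , b) with a < b.
  Ê : Set
  Ê = Σ (Fin n × Fin n) λ p → (proj₁ p < proj₂ p) × (T (adj G (proj₁ p) (proj₂ p)) ⊎ T (F (proj₁ p) (proj₂ p)))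

  ends : Ê → Fin n × Fin n
  ends = proj₁

  edgeOf : (u w : Fin n) → T (adj G u w) → Ê
  edgeOf u w p with <-cmp u w
  ... | tri< lt _ _ = (u , w) , lt , inj₁ p
  ... | tri≈ _ refl _ = ⊥-elim (subst T (irrefl G u) p)
  ... | tri> _ _ gt = (w , u) , gt , inj₁ (subst T (adj-sym G u w) p)

  data Walk : Fin n → Fin n → Set where
    []   : ∀ {u} → Walk u u
    step : ∀ {u w v} → T (adj G u w) → Walk w v → Walk u v

  verts : ∀ {u v} → Walk u v → List (Fin n)
  verts {u} [] = u ∷ []
  verts {u} (step _ r) = u ∷ verts r

  tailVerts : ∀ {u v} → Walk u v → List (Fin n)
  tailVerts [] = []
  tailVerts (step {w = w} _ r) = w ∷ tailVerts r

  edges : ∀ {u v} → Walk u v → List Ê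
  edges [] = []
  edges (step {u = u} {w = w} p r) = edgeOf u w p ∷ edges r

  IsPath : ∀ {u v} → Walk u v → Set
  IsPath w = Unique (verts w)

  IsCycle : ∀ {a} → Walk a a → Set
  IsCycle c = Unique (tailVerts c) × (3 ≤ length (tailVerts c))

  Connected : Set
  Connected = ∀ u v → Walk u v

  InducesConnected : (Fin n → Bool) → Set
  InducesConnected B = ∀ a b → T (B a) → T (B b) → Σ (Walk a b) λ w → All (T ∘ B) (verts w)

  -- A decomposition of G given by block labels π (blocks = nonempty fibres of π):
  -- each block induces a connected subgraph of G.
  IsDecomposition : (Fin n → Fin n) → Set
  IsDecomposition π = ∀ u v → π u ≡ π v → Σ (Walk u v) λ w → All (λ z → π z ≡ π u) (verts w)

  liftedMulticutVec : (Fin n → Fin n) → Ê → ℚ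
  liftedMulticutVec π e = if does (π (proj₁ (ends e)) ≟ᶠ π (proj₂ (ends e))) then 0ℚ else 1ℚ

  IsLiftedMulticutVec : (Ê → ℚ) → Set
  IsLiftedMulticutVec y = Σ (Fin n → Fin n) λ π → IsDecomposition π × (∀ e → y e ≡ liftedMulticutVec π e)

  IsUVDecomposition : (Fin n → Bool) → Fin n → Fin n → Set
  IsUVDecomposition U u v =
    ((T (U u) × T (not (U v))) ⊎ (T (not (U u)) × T (U v)))
    × InducesConnected U × InducesConnected (not ∘ U)

  -- contribution of pair (a,b) to Σ_{e ∈ δ(U)} (1 - x_e)
  cutTerm : (Fin n → Bool) → (Ê → ℚ) → Fin n → Fin n → ℚ
  cutTerm U x a b with a <? b
  ... | no _ = 0ℚ
  ... | yes lt with T? (adj G a b)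
  ...   | no _ = 0ℚ
  ...   | yes e = if U a xor U b then 1ℚ - x ((a , b) , lt , inj₁ e) else 0ℚ

  cutSum : (Fin n → Bool) → (Ê → ℚ) → ℚ
  cutSum U x = sumℚ (concatMap (λ a → map (cutTerm U x a) (allFin n)) (allFin n))

  sumExcept : (Ê → ℚ) → Ê → List Ê → ℚ
  sumExcept x f [] = 0ℚ
  sumExcept x f (e ∷ es) =
    (if does (proj₁ (ends e) ≟ᶠ proj₁ (ends f)) Data.Bool.∧ does (proj₂ (ends e) ≟ᶠ proj₂ (ends f))
      then 0ℚ else x e) + sumExcept x f es

  CycleIneqs : (Ê → ℚ) → Set
  CycleIneqs x = ∀ a (c : Walk a a) → IsCycle c → ∀ (f : Ê) → Any (λ e → ends e ≡ ends f) (edges c) →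
                 x f ≤ℚ sumExcept x f (edges c)

  PathIneqs : (Ê → ℚ) → Set
  PathIneqs x = ∀ u v (lt : u < v) (fu : T (F u v)) (P : Walk u v) → IsPath P →
                x ((u , v) , lt , inj₂ fu) ≤ℚ sumℚ (map x (edges P))

  CutIneqs : (Ê → ℚ) → Set
  CutIneqs x = ∀ u v (lt : u < v) (fu : T (F u v)) (U : Fin n → Bool) → IsUVDecomposition U u v →
               1ℚ - x ((u , v) , lt , inj₂ fu) ≤ℚ cutSum U x

  IsFeasible01 : (Ê → ℚ) → Set
  IsFeasible01 x = (∀ e → (x e ≡ 0ℚ) ⊎ (x e ≡ 1ℚ)) × CycleIneqs x × PathIneqs x × CutIneqs x

  -- (rational points of the) convex hull of a set S of vectors in ℚ^{E∪F}
  ConvHull : ((Ê → ℚ) → Set) → (Ê → ℚ) → Set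
  ConvHull S x = Σ (List (ℚ × (Ê → ℚ))) λ cs →
      All (λ p → (0ℚ ≤ℚ proj₁ p) × S (proj₂ p)) cs
    × (sumℚ (map proj₁ cs) ≡ 1ℚ)
    × (∀ e → x e ≡ sumℚ (map (λ p → proj₁ p * proj₂ p e) cs))

  LMC : (Ê → ℚ) → Set
  LMC = ConvHull IsLiftedMulticutVec

-- If π is a decomposition of G, its lifted multicut vector satisfies (1)–(3): along a walk the
-- block of π changes only across cut edges, and an uncut F-edge uv comes with a walk from u to v
-- inside one block, which must cross every uv-cut δ(U) through an uncut edge.
-- Conversely, a feasible 0/1 vector x is the lifted multicut vector of the decomposition into the
-- components of the graph of G-edges of value 0. An edge of value 1 inside a component closes a cycle
-- (a G-edge) or spans a path (an F-edge) of value 0, violating (1) or (2). An F-edge uv of value 0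
-- joining two components violates (3) for U = V ∖ W, where W is the component of v in G minus
-- the component C of u: every G-edge leaving W ends in C, hence has value 1.
-- Both directions pass to convex hulls.
module Submission where

open import Level using (Level; 0ℓ)
open import Data.Nat using (ℕ; zero; suc; z≤n; s≤s) renaming (_≤_ to _≤ℕ_)
import Data.Nat.Properties as ℕ
open import Data.Fin using (Fin; zero; suc; _<_; _<?_)
open import Data.Fin.Properties
  using (any?; injective⇒≤; <-cmp; <-asym; <-irrelevant) renaming (_≟_ to _≟ᶠ_)
open import Data.Bool using (Bool; true; false; T; T?; not; _xor_; _∧_; if_then_else_)
open import Data.Bool.Properties using (T-irrelevant) renaming (_≟_ to _≟ᵇ_)
open import Data.List using (List; []; _∷_; length; lookup; allFin; find; map; concatMap)
open import Data.List.Relation.Unary.All as All using (All; []; _∷_)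
import Data.List.Relation.Unary.All.Properties as All
import Data.List.Relation.Unary.Any.Properties as Any
open import Data.List.Relation.Unary.Any as Any using (Any; here; there)
open import Data.List.Relation.Unary.Unique.Propositional using (Unique)
open import Data.List.Relation.Unary.AllPairs using ([]; _∷_)
open import Data.List.Membership.Propositional using (_∈_)
open import Data.List.Membership.Propositional.Properties using (∈-allFin; ∈-lookup)
open import Data.Maybe using (just; fromMaybe)
open import Data.Product using (Σ; ∃; _×_; _,_; proj₁; proj₂)
open import Data.Product.Properties using (×-≡,≡→≡; ≡-dec)
open import Data.Sum using (_⊎_; inj₁; inj₂)
open import Data.Empty using (⊥; ⊥-elim)
open import Data.Rational using (ℚ; 0ℚ; 1ℚ; _+_; _-_) renaming (_≤_ to _≤ℚ_)
import Data.Rational.Properties as ℚ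
open import Function using (_∘_)
open import Relation.Binary using (Rel; Decidable; DecidableEquality; Symmetric; Tri; tri<; tri≈; tri>)
open import Function.Bundles using (_⇔_; mk⇔)
open import Relation.Binary.PropositionalEquality using (_≡_; _≢_; refl; sym; trans; cong; subst)
open import Relation.Binary.Construct.Closure.ReflexiveTransitive as Star using (Star; ε; _◅_; _◅◅_)
import Relation.Unary
open import Relation.Nullary using (¬_; yes; no; does)
open import Relation.Nullary.Decidable
  using (map′; _×-dec_; _⊎-dec_; from-yes; from-no; dec-true; dec-false; ¬?; decidable-stable)

open import Defs

private variable
  a ℓ p : Level

sumℚ-nonneg : ∀ {qs} → All (0ℚ ≤ℚ_) qs → 0ℚ ≤ℚ sumℚ qs
sumℚ-nonneg []       = ℚ.≤-refl
sumℚ-nonneg (q ∷ qs) = ℚ.+-mono-≤ q (sumℚ-nonneg qs)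

sumℚ-≥1 : ∀ {qs} → All (0ℚ ≤ℚ_) qs → Any (1ℚ ≤ℚ_) qs → 1ℚ ≤ℚ sumℚ qs
sumℚ-≥1 (_ ∷ qs) (here q)  = ℚ.+-mono-≤ q (sumℚ-nonneg qs)
sumℚ-≥1 (q ∷ qs) (there i) = ℚ.+-mono-≤ q (sumℚ-≥1 qs i)

sumℚ-zero : ∀ {qs} → All (_≡ 0ℚ) qs → sumℚ qs ≡ 0ℚ
sumℚ-zero []          = refl
sumℚ-zero (refl ∷ qs) = cong (0ℚ +_) (sumℚ-zero qs)

module _ {A : Set a} {R : Rel A ℓ} where

  vertices : ∀ {u v} → Star R u v → List A
  vertices {u} ε       = u ∷ []
  vertices {u} (_ ◅ w) = u ∷ vertices w

  steps : ∀ {u v} → Star R u v → ℕ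
  steps ε       = zero
  steps (_ ◅ w) = suc (steps w)

  length-vertices : ∀ {u v} (w : Star R u v) → length (vertices w) ≡ suc (steps w)
  length-vertices ε       = refl
  length-vertices (_ ◅ w) = cong suc (length-vertices w)

  module _ {P : A → Set p} (preserves : ∀ {y z} → R y z → P y → P z) where

    Star-preserves : ∀ {u v} → P u → Star R u v → P v
    Star-preserves pu ε       = pu
    Star-preserves pu (r ◅ w) = Star-preserves (preserves r pu) w

    All-vertices : ∀ {u v} → P u → (w : Star R u v) → All P (vertices w)
    All-vertices pu ε       = pu ∷ []
    All-vertices pu (r ◅ w) = pu ∷ All-vertices (preserves r pu) w

    restrict : ∀ {u v} → P u → Star R u v → Star (λ y z → R y z × P y × P z) u v
    restrict pu ε       = ε
    restrict pu (r ◅ w) = (r , pu , preserves r pu) ◅ restrict (preserves r pu) w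

module _ {A : Set a} (_≟_ : DecidableEquality A) {R : Rel A ℓ} where
  open import Data.List.Membership.DecPropositional _≟_ using (_∈?_)

  dropUntil : ∀ {u s v} (w : Star R s v) → u ∈ vertices w → Star R u v
  dropUntil ε       (here refl) = ε
  dropUntil (r ◅ w) (here refl) = r ◅ w
  dropUntil (_ ◅ w) (there i)   = dropUntil w i

  dropUntil-unique : ∀ {u s v} (w : Star R s v) (i : u ∈ vertices w) →
                     Unique (vertices w) → Unique (vertices (dropUntil w i))
  dropUntil-unique ε       (here refl) un       = un
  dropUntil-unique (_ ◅ _) (here refl) un       = un
  dropUntil-unique (_ ◅ w) (there i)   (_ ∷ un) = dropUntil-unique w i un

  loopErase : ∀ {u v} → Star R u v → Σ (Star R u v) (Unique ∘ vertices)
  loopErase ε = ε , [] ∷ []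
  loopErase {u} (r ◅ w) with loopErase w
  ... | w′ , un with u ∈? vertices w′
  ...   | yes i = dropUntil w′ i , dropUntil-unique w′ i un
  ...   | no  i = r ◅ w′ , All.¬Any⇒All¬ (vertices w′) i ∷ un

lookup-injective : {A : Set a} {xs : List A} → Unique xs →
                   ∀ {i j} → lookup xs i ≡ lookup xs j → i ≡ j
lookup-injective (_ ∷ _)  {zero}  {zero}  _  = refl
lookup-injective (x∉ ∷ _) {zero}  {suc j} eq = ⊥-elim (All.lookup x∉ (∈-lookup j) eq)
lookup-injective (x∉ ∷ _) {suc i} {zero}  eq = ⊥-elim (All.lookup x∉ (∈-lookup i) (sym eq))
lookup-injective (_ ∷ un) {suc i} {suc j} eq = cong suc (lookup-injective un eq)

unique-length≤ : ∀ {n} {xs : List (Fin n)} → Unique xs → length xs ≤ℕ n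
unique-length≤ un = injective⇒≤ (lookup-injective un)

module _ {n} {R : Rel (Fin n) ℓ} (R? : Decidable R) where

  reachableWithin? : ∀ k → Decidable (λ u v → Σ (Star R u v) λ w → steps w ≤ℕ k)
  reachableWithin? zero u v = map′ (λ { refl → ε , z≤n }) (λ { (ε , _) → refl }) (u ≟ᶠ v)
  reachableWithin? (suc k) u v =
    map′ fromStep toStep ((u ≟ᶠ v) ⊎-dec any? (λ w → R? u w ×-dec reachableWithin? k w v))
    where
    fromStep : u ≡ v ⊎ ∃ (λ w → R u w × Σ (Star R w v) λ r → steps r ≤ℕ k) →
               Σ (Star R u v) λ r → steps r ≤ℕ suc k
    fromStep (inj₁ refl)               = ε , z≤n
    fromStep (inj₂ (_ , e , r , r≤k)) = e ◅ r , s≤s r≤k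
    toStep : Σ (Star R u v) (λ r → steps r ≤ℕ suc k) →
             u ≡ v ⊎ ∃ (λ w → R u w × Σ (Star R w v) λ r → steps r ≤ℕ k)
    toStep (ε , _)           = inj₁ refl
    toStep (e ◅ r , s≤s r≤k) = inj₂ (_ , e , r , r≤k)

  -- A loop-free walk visits at most n vertices, so it has fewer than n steps.
  reachable? : Decidable (Star R)
  reachable? u v = map′ proj₁ shortWalk (reachableWithin? n u v)
    where
    shortWalk : Star R u v → Σ (Star R u v) λ w → steps w ≤ℕ n
    shortWalk w with loopErase _≟ᶠ_ w
    ... | w′ , un = w′ , ℕ.<⇒≤ (subst (_≤ℕ n) (length-vertices w′) (unique-length≤ un))

module _ {A : Set a} {P : A → Set p} (P? : Relation.Unary.Decidable P) where

  find-sound : ∀ {xs z} → find P? xs ≡ just z → P z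
  find-sound {x ∷ xs} eq with P? x
  find-sound {x ∷ xs} refl | yes px = px
  ... | no _ = find-sound {xs} eq

  find-complete : ∀ {xs x} → x ∈ xs → P x → ∃ λ z → find P? xs ≡ just z
  find-complete {y ∷ xs} i px with P? y
  ... | yes _ = y , refl
  find-complete {y ∷ xs} (here refl) px | no ¬py = ⊥-elim (¬py px)
  find-complete {y ∷ xs} (there i)   px | no _   = find-complete i px

  find-cong : {Q : A → Set p} (Q? : Relation.Unary.Decidable Q) →
              (∀ {x} → P x → Q x) → (∀ {x} → Q x → P x) →
              ∀ xs → find P? xs ≡ find Q? xs
  find-cong Q? P⇒Q Q⇒P []       = refl
  find-cong Q? P⇒Q Q⇒P (x ∷ xs) with P? x | Q? x
  ... | yes _  | yes _  = refl
  ... | no _   | no _   = find-cong Q? P⇒Q Q⇒P xs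
  ... | yes px | no ¬qx = ⊥-elim (¬qx (P⇒Q px))
  ... | no ¬px | yes qx = ⊥-elim (¬px (Q⇒P qx))

module Representative {n} {R : Rel (Fin n) ℓ} (R? : Decidable R) (R-sym : Symmetric R) where

  Star-sym : Symmetric (Star R)
  Star-sym = Star.reverse R-sym

  -- The default u of fromMaybe is never used, since u reaches itself.
  representative : Fin n → Fin n
  representative u = fromMaybe u (find (reachable? R? u) (allFin n))

  private
    firstReachable : ∀ u → ∃ λ z → find (reachable? R? u) (allFin n) ≡ just z
    firstReachable u = find-complete (reachable? R? u) (∈-allFin u) ε

    representative-≡ : ∀ {u z} → find (reachable? R? u) (allFin n) ≡ just z → representative u ≡ z
    representative-≡ eq rewrite eq = refl

  reaches-representative : ∀ u → Star R u (representative u)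
  reaches-representative u with firstReachable u
  ... | z , eq = subst (Star R u) (sym (representative-≡ eq)) (find-sound (reachable? R? u) {allFin n} eq)

  Star⇒representative≡ : ∀ {u v} → Star R u v → representative u ≡ representative v
  Star⇒representative≡ {u} {v} u⇝v with firstReachable u
  ... | z , eq = trans (representative-≡ eq) (sym (representative-≡ (trans (sym sameSearch) eq)))
    where
    sameSearch : find (reachable? R? u) (allFin n) ≡ find (reachable? R? v) (allFin n)
    sameSearch = find-cong (reachable? R? u) (reachable? R? v)
                   (Star-sym u⇝v ◅◅_) (u⇝v ◅◅_) (allFin n)

  representative≡⇒Star : ∀ {u v} → representative u ≡ representative v → Star R u v
  representative≡⇒Star {u} {v} eq =
    reaches-representative u ◅◅ subst (λ z → Star R z v) (sym eq) (Star-sym (reaches-representative v))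

xor≡true⇒≢ : ∀ {x y} → x xor y ≡ true → x ≢ y
xor≡true⇒≢ {true}  {true}  () _
xor≡true⇒≢ {false} {false} () _

≢⇒xor≡true : ∀ {x y} → x ≢ y → x xor y ≡ true
≢⇒xor≡true {true}  {true}  x≢y = ⊥-elim (x≢y refl)
≢⇒xor≡true {true}  {false} _   = refl
≢⇒xor≡true {false} {true}  _   = refl
≢⇒xor≡true {false} {false} x≢y = ⊥-elim (x≢y refl)

separates⇒≢ : ∀ {x y} → (T x × T (not y)) ⊎ (T (not x) × T y) → x ≢ y
separates⇒≢ {true}  {true}  (inj₁ (_ , ()))
separates⇒≢ {false} {false} (inj₂ (_ , ()))
separates⇒≢ {true}  {false} _ ()
separates⇒≢ {false} {true}  _ ()

ZeroOne : ℚ → Set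
ZeroOne q = q ≡ 0ℚ ⊎ q ≡ 1ℚ

zeroOne-nonneg : ∀ {q} → ZeroOne q → 0ℚ ≤ℚ q
zeroOne-nonneg (inj₁ refl) = ℚ.≤-refl
zeroOne-nonneg (inj₂ refl) = from-yes (0ℚ ℚ.≤? 1ℚ)

zeroOne-complement-nonneg : ∀ {q} → ZeroOne q → 0ℚ ≤ℚ 1ℚ - q
zeroOne-complement-nonneg (inj₁ refl) = zeroOne-nonneg (inj₂ refl)
zeroOne-complement-nonneg (inj₂ refl) = ℚ.≤-refl

1≰0 : ¬ 1ℚ ≤ℚ 0ℚ
1≰0 = from-no (1ℚ ℚ.≤? 0ℚ)

module _ {n} {P : ℚ → Set p} (g : Fin n → Fin n → ℚ) where

  All-pairs : (∀ a b → P (g a b)) → All P (concatMap (λ a → map (g a) (allFin n)) (allFin n))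
  All-pairs h = All.concat⁺ (All.map⁺ (All.tabulate⁺ λ a → All.map⁺ (All.tabulate⁺ (h a))))

  Any-pairs : ∀ a b → P (g a b) → Any P (concatMap (λ a → map (g a) (allFin n)) (allFin n))
  Any-pairs a b q = Any.concat⁺ (Any.map⁺ (Any.tabulate⁺ a (Any.map⁺ (Any.tabulate⁺ b q))))

module Graph {n} (G : SimpleGraph n) (F : Fin n → Fin n → Bool)
             (E∩F≡∅ : ∀ u v → T (F u v) → ¬ T (adj G u v)) where

  data Joins (e : Ê G F) (u w : Fin n) : Set where
    forward  : ends G F e ≡ (u , w) → Joins e u w
    backward : ends G F e ≡ (w , u) → Joins e u w

  Parallel : Ê G F → Ê G F → Set
  Parallel f e = ends G F e ≡ ends G F f

  parallel? : ∀ f → Relation.Unary.Decidable (Parallel f)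
  parallel? f e = ≡-dec _≟ᶠ_ _≟ᶠ_ (ends G F e) (ends G F f)

  joins-sym : ∀ {e u w} → Joins e u w → Joins e w u
  joins-sym (forward eq)  = backward eq
  joins-sym (backward eq) = forward eq

  parallel-joins : ∀ {f e u w} → Parallel f e → Joins e u w → Joins f u w
  parallel-joins e∥f (forward eq)  = forward (trans (sym e∥f) eq)
  parallel-joins e∥f (backward eq) = backward (trans (sym e∥f) eq)

  edgeOf-joins : ∀ u w (p : T (adj G u w)) → Joins (edgeOf G F u w p) u w
  edgeOf-joins u w p with <-cmp u w
  ... | tri< _ _ _    = forward refl
  ... | tri≈ _ refl _ = ⊥-elim (subst T (irrefl G u) p)
  ... | tri> _ _ _    = backward refl

  ends-injective : ∀ {e e′ : Ê G F} → ends G F e ≡ ends G F e′ → e ≡ e′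
  ends-injective {(a , b) , lt , s} {_ , lt′ , s′} refl
    rewrite <-irrelevant lt lt′ = cong (λ s → (a , b) , lt′ , s) (sameKind s s′)
    where
    sameKind : (s s′ : T (adj G a b) ⊎ T (F a b)) → s ≡ s′
    sameKind (inj₁ p) (inj₁ q) = cong inj₁ (T-irrelevant p q)
    sameKind (inj₂ p) (inj₂ q) = cong inj₂ (T-irrelevant p q)
    sameKind (inj₁ p) (inj₂ q) = ⊥-elim (E∩F≡∅ a b q p)
    sameKind (inj₂ p) (inj₁ q) = ⊥-elim (E∩F≡∅ a b p q)

  private
    sorted : (e : Ê G F) → ∀ {s t} → ends G F e ≡ (s , t) → s < t
    sorted e refl = proj₁ (proj₂ e)

  joins-unique : ∀ {e e′ u w} → Joins e u w → Joins e′ u w → e ≡ e′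
  joins-unique         (forward e≡)  (forward e′≡)  = ends-injective (trans e≡ (sym e′≡))
  joins-unique         (backward e≡) (backward e′≡) = ends-injective (trans e≡ (sym e′≡))
  joins-unique {e} {e′} (forward e≡)  (backward e′≡) = ⊥-elim (<-asym (sorted e e≡) (sorted e′ e′≡))
  joins-unique {e} {e′} (backward e≡) (forward e′≡)  = ⊥-elim (<-asym (sorted e e≡) (sorted e′ e′≡))

  edgeOf-sym : ∀ {u w} (p : T (adj G u w)) (q : T (adj G w u)) → edgeOf G F u w p ≡ edgeOf G F w u q
  edgeOf-sym {u} {w} p q = joins-unique (edgeOf-joins u w p) (joins-sym (edgeOf-joins w u q))

  edgeOf-irrelevant : ∀ {u w} (p q : T (adj G u w)) → edgeOf G F u w p ≡ edgeOf G F u w q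
  edgeOf-irrelevant {u} {w} p q = joins-unique (edgeOf-joins u w p) (edgeOf-joins u w q)

  sorted-edge≡edgeOf : ∀ {a b} (lt : a < b) (p : T (adj G a b)) → ((a , b) , lt , inj₁ p) ≡ edgeOf G F a b p
  sorted-edge≡edgeOf {a} {b} lt p = joins-unique (forward refl) (edgeOf-joins a b p)

  adj-sym′ : ∀ {u w} → T (adj G u w) → T (adj G w u)
  adj-sym′ {u} {w} = subst T (adj-sym G u w)

  adj-irrefl : ∀ {u w} → T (adj G u w) → u ≢ w
  adj-irrefl {u} p refl = subst T (irrefl G u) p

  toWalk : {R : Rel (Fin n) ℓ} → (∀ {y z} → R y z → T (adj G y z)) →
           ∀ {u v} → Star R u v → Walk G F u v
  toWalk R⊆E ε       = []
  toWalk R⊆E (r ◅ w) = step (R⊆E r) (toWalk R⊆E w)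

  verts-toWalk : {R : Rel (Fin n) ℓ} (R⊆E : ∀ {y z} → R y z → T (adj G y z)) →
                 ∀ {u v} (w : Star R u v) → verts G F (toWalk R⊆E w) ≡ vertices w
  verts-toWalk R⊆E ε       = refl
  verts-toWalk R⊆E (_ ◅ w) = cong (_ ∷_) (verts-toWalk R⊆E w)

  tailVerts-step : ∀ {s w t} (p : T (adj G s w)) (r : Walk G F w t) → tailVerts G F (step p r) ≡ verts G F r
  tailVerts-step p []         = refl
  tailVerts-step p (step q r) = cong (_ ∷_) (tailVerts-step q r)

  head∈verts : ∀ {s t} (r : Walk G F s t) → s ∈ verts G F r
  head∈verts []         = here refl
  head∈verts (step _ _) = here refl

  last∈verts : ∀ {s t} (r : Walk G F s t) → t ∈ verts G F r
  last∈verts []         = here refl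
  last∈verts (step _ r) = there (last∈verts r)

  module _ (U : Fin n → Bool) (x : Ê G F → ℚ) where

    cutTerm-nonneg : (∀ e → ZeroOne (x e)) → ∀ a b → 0ℚ ≤ℚ cutTerm G F U x a b
    cutTerm-nonneg zeroOne a b with a <? b
    ... | no _ = ℚ.≤-refl
    ... | yes lt with T? (adj G a b)
    ...   | no _ = ℚ.≤-refl
    ...   | yes p with U a xor U b
    ...     | true  = zeroOne-complement-nonneg (zeroOne _)
    ...     | false = ℚ.≤-refl

    cutTerm-crossing : ∀ {a b} (lt : a < b) (p : T (adj G a b)) → U a ≢ U b →
                       x ((a , b) , lt , inj₁ p) ≡ 0ℚ → cutTerm G F U x a b ≡ 1ℚ
    cutTerm-crossing {a} {b} lt p Ua≢Ub x≡0 with a <? b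
    ... | no ¬lt = ⊥-elim (¬lt lt)
    ... | yes lt′ with T? (adj G a b)
    ...   | no ¬p = ⊥-elim (¬p p)
    ...   | yes p′ rewrite ≢⇒xor≡true Ua≢Ub = cong (1ℚ -_) (trans (cong x (ends-injective refl)) x≡0)

    cutTerm-zero : ∀ {a b} →
                   (∀ (lt : a < b) (p : T (adj G a b)) → U a ≢ U b → x ((a , b) , lt , inj₁ p) ≡ 1ℚ) →
                   cutTerm G F U x a b ≡ 0ℚ
    cutTerm-zero {a} {b} crossing⇒1 with a <? b
    ... | no _ = refl
    ... | yes lt with T? (adj G a b)
    ...   | no _ = refl
    ...   | yes p with U a xor U b in eq
    ...     | false = refl
    ...     | true  = cong (1ℚ -_) (crossing⇒1 lt p (xor≡true⇒≢ eq))

    cutSum-nonneg : (∀ e → ZeroOne (x e)) → 0ℚ ≤ℚ cutSum G F U x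
    cutSum-nonneg zeroOne = sumℚ-nonneg (All-pairs (cutTerm G F U x) (cutTerm-nonneg zeroOne))

    cutSum-zero : (∀ a b → cutTerm G F U x a b ≡ 0ℚ) → cutSum G F U x ≡ 0ℚ
    cutSum-zero h = sumℚ-zero (All-pairs (cutTerm G F U x) h)

    cutTerm≡1⇒cutSum≥1 : (∀ e → ZeroOne (x e)) → ∀ a b →
                         cutTerm G F U x a b ≡ 1ℚ → 1ℚ ≤ℚ cutSum G F U x
    cutTerm≡1⇒cutSum≥1 zeroOne a b eq = sumℚ-≥1 (All-pairs (cutTerm G F U x) (cutTerm-nonneg zeroOne))
                                                 (Any-pairs (cutTerm G F U x) a b (ℚ.≤-reflexive (sym eq)))

    crossing-zero-edge⇒cutSum≥1 : (∀ e → ZeroOne (x e)) → ∀ {a b} (p : T (adj G a b)) → U a ≢ U b →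
                                   x (edgeOf G F a b p) ≡ 0ℚ → 1ℚ ≤ℚ cutSum G F U x
    crossing-zero-edge⇒cutSum≥1 zeroOne {a} {b} p Ua≢Ub x≡0 = byOrder (<-cmp a b)
      where
      byOrder : Tri (a < b) (a ≡ b) (b < a) → 1ℚ ≤ℚ cutSum G F U x
      byOrder (tri< lt _ _) = cutTerm≡1⇒cutSum≥1 zeroOne a b
        (cutTerm-crossing lt p Ua≢Ub (trans (cong x (sorted-edge≡edgeOf lt p)) x≡0))
      byOrder (tri≈ _ a≡b _) = ⊥-elim (adj-irrefl p a≡b)
      byOrder (tri> _ _ gt) = cutTerm≡1⇒cutSum≥1 zeroOne b a
        (cutTerm-crossing gt (adj-sym′ p) (Ua≢Ub ∘ sym)
          (trans (cong x (trans (sorted-edge≡edgeOf gt (adj-sym′ p)) (edgeOf-sym (adj-sym′ p) p))) x≡0))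

  exceptTerm : (Ê G F → ℚ) → Ê G F → Ê G F → ℚ
  exceptTerm x f e =
    if does (proj₁ (ends G F e) ≟ᶠ proj₁ (ends G F f))
     ∧ does (proj₂ (ends G F e) ≟ᶠ proj₂ (ends G F f))
      then 0ℚ else x e

  sumExcept≡sumℚ : ∀ x f es → sumExcept G F x f es ≡ sumℚ (map (exceptTerm x f) es)
  sumExcept≡sumℚ x f []       = refl
  sumExcept≡sumℚ x f (e ∷ es) = cong (exceptTerm x f e +_) (sumExcept≡sumℚ x f es)

  exceptTerm-parallel : ∀ x {e f} → Parallel f e → exceptTerm x f e ≡ 0ℚ
  exceptTerm-parallel x {e} {f} eq
    rewrite dec-true (proj₁ (ends G F e) ≟ᶠ proj₁ (ends G F f)) (cong proj₁ eq)
          | dec-true (proj₂ (ends G F e) ≟ᶠ proj₂ (ends G F f)) (cong proj₂ eq) = refl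

  exceptTerm-other : ∀ x {e f} → ¬ Parallel f e → exceptTerm x f e ≡ x e
  exceptTerm-other x {e} {f} e≢f
    with proj₁ (ends G F e) ≟ᶠ proj₁ (ends G F f) | proj₂ (ends G F e) ≟ᶠ proj₂ (ends G F f)
  ... | yes eq₁ | yes eq₂ = ⊥-elim (e≢f (×-≡,≡→≡ (eq₁ , eq₂)))
  ... | yes _   | no _    = refl
  ... | no _    | _       = refl

  exceptTerm-nonneg : ∀ {x} → (∀ e → 0ℚ ≤ℚ x e) → ∀ f e → 0ℚ ≤ℚ exceptTerm x f e
  exceptTerm-nonneg {x} x≥0 f e with parallel? f e
  ... | yes eq  = ℚ.≤-reflexive (sym (exceptTerm-parallel x {e} {f} eq))
  ... | no  e≢f = subst (0ℚ ≤ℚ_) (sym (exceptTerm-other x {e} {f} e≢f)) (x≥0 e)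

  sumExcept-nonneg : ∀ {x} → (∀ e → 0ℚ ≤ℚ x e) → ∀ f es → 0ℚ ≤ℚ sumExcept G F x f es
  sumExcept-nonneg {x} x≥0 f es = subst (0ℚ ≤ℚ_) (sym (sumExcept≡sumℚ x f es))
    (sumℚ-nonneg (All.map⁺ (All.universal (exceptTerm-nonneg x≥0 f) es)))

  sumExcept-≥1 : ∀ {x} → (∀ e → 0ℚ ≤ℚ x e) → ∀ f {es} →
                 Any (λ e → ¬ Parallel f e × x e ≡ 1ℚ) es →
                 1ℚ ≤ℚ sumExcept G F x f es
  sumExcept-≥1 {x} x≥0 f {es} i = subst (1ℚ ≤ℚ_) (sym (sumExcept≡sumℚ x f es))
    (sumℚ-≥1 (All.map⁺ (All.universal (exceptTerm-nonneg x≥0 f) es))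
             (Any.map⁺ (Any.map (λ {e} (e≢f , x≡1) →
                ℚ.≤-reflexive (sym (trans (exceptTerm-other x {e} {f} e≢f) x≡1))) i)))

  sumExcept-zero : ∀ x f {es} → All (λ e → Parallel f e ⊎ x e ≡ 0ℚ) es → sumExcept G F x f es ≡ 0ℚ
  sumExcept-zero x f {es} zs =
    trans (sumExcept≡sumℚ x f es) (sumℚ-zero (All.map⁺ {xs = es} (All.map term≡0 zs)))
    where
    term≡0 : ∀ {e} → Parallel f e ⊎ x e ≡ 0ℚ → exceptTerm x f e ≡ 0ℚ
    term≡0 {e} (inj₁ e∥f) = exceptTerm-parallel x {e} {f} e∥f
    term≡0 {e} (inj₂ x≡0) with parallel? f e
    ... | yes e∥f = exceptTerm-parallel x {e} {f} e∥f
    ... | no  e≢f = trans (exceptTerm-other x {e} {f} e≢f) x≡0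

  Endpoint : Ê G F → Fin n → Set
  Endpoint e v = v ≡ proj₁ (ends G F e) ⊎ v ≡ proj₂ (ends G F e)

  joins-endpoint : ∀ {e u w v} → Joins e u w → Endpoint e v → v ≡ u ⊎ v ≡ w
  joins-endpoint (forward eq)  (inj₁ v≡) = inj₁ (trans v≡ (cong proj₁ eq))
  joins-endpoint (forward eq)  (inj₂ v≡) = inj₂ (trans v≡ (cong proj₂ eq))
  joins-endpoint (backward eq) (inj₁ v≡) = inj₂ (trans v≡ (cong proj₁ eq))
  joins-endpoint (backward eq) (inj₂ v≡) = inj₁ (trans v≡ (cong proj₂ eq))

  endpoint-joins : ∀ {e u w} → Joins e u w → Endpoint e u × Endpoint e w
  endpoint-joins (forward eq)  = inj₁ (sym (cong proj₁ eq)) , inj₂ (sym (cong proj₂ eq))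
  endpoint-joins (backward eq) = inj₂ (sym (cong proj₂ eq)) , inj₁ (sym (cong proj₁ eq))

  endpoint-parallel : ∀ {f e v} → Parallel f e → Endpoint f v → Endpoint e v
  endpoint-parallel e∥f (inj₁ v≡) = inj₁ (trans v≡ (sym (cong proj₁ e∥f)))
  endpoint-parallel e∥f (inj₂ v≡) = inj₂ (trans v≡ (sym (cong proj₂ e∥f)))

  parallel-endpoint∈verts : ∀ {f v s t} (r : Walk G F s t) → Any (Parallel f) (edges G F r) → Endpoint f v →
                            v ∈ verts G F r
  parallel-endpoint∈verts {f} (step {u = s} {w = w} p r) (here e∥f) v∈f
    with joins-endpoint (edgeOf-joins s w p) (endpoint-parallel {f} {edgeOf G F s w p} e∥f v∈f)
  ... | inj₁ refl = here refl
  ... | inj₂ refl = there (head∈verts r)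
  parallel-endpoint∈verts {f} (step p r) (there i) v∈f = there (parallel-endpoint∈verts {f} r i v∈f)

  crossing-edge : ∀ {Q : Fin n → Set} (U : Fin n → Bool) {s t} (r : Walk G F s t) →
                  All Q (verts G F r) → U s ≢ U t →
                  Σ (Fin n) λ a → Σ (Fin n) λ b → T (adj G a b) × U a ≢ U b × Q a × Q b
  crossing-edge U []                           _        Us≢Ut = ⊥-elim (Us≢Ut refl)
  crossing-edge U (step {u = s} {w = w} p r) (qs ∷ qr) Us≢Ut with U s ≟ᵇ U w
  ... | yes Us≡Uw = crossing-edge U r qr (Us≢Ut ∘ trans Us≡Uw)
  ... | no  Us≢Uw = s , w , p , Us≢Uw , qs , All.lookup qr (head∈verts r)

  Within : (Fin n → Bool) → Rel (Fin n) 0ℓ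
  Within S y z = T (adj G y z) × T (S y) × T (S z)

  within-sym : ∀ {S} → Symmetric (Within S)
  within-sym (p , Sy , Sz) = adj-sym′ p , Sz , Sy

  hub⇒inducesConnected : ∀ (S : Fin n → Bool) c → (∀ y → T (S y) → Star (Within S) y c) →
                         InducesConnected G F S
  hub⇒inducesConnected S c reach y z Sy Sz =
    toWalk proj₁ w ,
    subst (All (T ∘ S)) (sym (verts-toWalk proj₁ w)) (All-vertices (λ e _ → proj₂ (proj₂ e)) Sy w)
    where w = reach y Sy ◅◅ Star.reverse within-sym (reach z Sz)

  module LiftedMulticut (π : Fin n → Fin n) where

    Uncut : Ê G F → Set
    Uncut e = π (proj₁ (ends G F e)) ≡ π (proj₂ (ends G F e))

    uncut? : Relation.Unary.Decidable Uncut
    uncut? e = π (proj₁ (ends G F e)) ≟ᶠ π (proj₂ (ends G F e))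

    uncut-joins : ∀ {e u w} → Joins e u w → Uncut e → π u ≡ π w
    uncut-joins (forward eq)  unc = subst (λ q → π (proj₁ q) ≡ π (proj₂ q)) eq unc
    uncut-joins (backward eq) unc = sym (subst (λ q → π (proj₁ q) ≡ π (proj₂ q)) eq unc)

    joins-uncut : ∀ {e u w} → Joins e u w → π u ≡ π w → Uncut e
    joins-uncut (forward eq)  πu≡πw = subst (λ q → π (proj₁ q) ≡ π (proj₂ q)) (sym eq) πu≡πw
    joins-uncut (backward eq) πu≡πw = subst (λ q → π (proj₁ q) ≡ π (proj₂ q)) (sym eq) (sym πu≡πw)

    uncut-walk : ∀ {s t} (r : Walk G F s t) → All Uncut (edges G F r) → π s ≡ π t
    uncut-walk []         []         = refl
    uncut-walk (step p r) (unc ∷ us) = trans (uncut-joins (edgeOf-joins _ _ p) unc) (uncut-walk r us)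

    module _ (f : Ê G F) (f-cut : ¬ Uncut f) where

      private
        onlyUncut : ∀ {es} → ¬ Any (Parallel f) es → All (λ e → Parallel f e ⊎ Uncut e) es →
                    All Uncut es
        onlyUncut noPar ps =
          All.zipWith (λ { (¬par , inj₁ par) → ⊥-elim (¬par par) ; (_ , inj₂ unc) → unc })
                      (All.¬Any⇒All¬ _ noPar , ps)

      -- On a path, the edges parallel to f are only crossed once, so the π-class changes exactly once.
      cut-path : ∀ {s t} (P : Walk G F s t) → Unique (verts G F P) →
                 All (λ e → Parallel f e ⊎ Uncut e) (edges G F P) → Any (Parallel f) (edges G F P) →
                 π s ≢ π t
      cut-path (step {u = s} {w = w} p r) (s∉r ∷ unique) (h ∷ hs) i πs≡πt
        with parallel? f (edgeOf G F s w p) | h | i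
      ... | yes e∥f | _ | _ =
        f-cut (joins-uncut f-joins (trans πs≡πt (sym (uncut-walk r (onlyUncut noParallel hs)))))
        where
        f-joins : Joins f s w
        f-joins = parallel-joins e∥f (edgeOf-joins s w p)
        noParallel : ¬ Any (Parallel f) (edges G F r)
        noParallel j = All.lookup s∉r (parallel-endpoint∈verts {f} r j (proj₁ (endpoint-joins f-joins))) refl
      ... | no ¬e∥f | inj₁ e∥f | _       = ¬e∥f e∥f
      ... | no ¬e∥f | inj₂ _   | here e∥f = ¬e∥f e∥f
      ... | no _    | inj₂ unc | there j =
        cut-path r unique hs j (trans (sym (uncut-joins (edgeOf-joins s w p) unc)) πs≡πt)

      -- If the first edge a → w is parallel to f, the rest of the cycle is a path from w back to a
      -- that avoids f, so π a ≡ π w; otherwise cut-path applies to the rest.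
      cut-cycle : ∀ {a} (c : Walk G F a a) → IsCycle G F c →
                  All (λ e → Parallel f e ⊎ Uncut e) (edges G F c) → Any (Parallel f) (edges G F c) → ⊥
      cut-cycle (step p [])          (_ , s≤s ())
      cut-cycle (step p (step q []))  (_ , s≤s (s≤s ()))
      cut-cycle (step {u = a} {w = w} p rest@(step {w = z} q rest′@(step q′ r))) (unique , _) (h ∷ hs) i
        with subst Unique (tailVerts-step p rest) unique
      ... | uniqueRest@(w∉ ∷ z∉ ∷ _)
        with parallel? f (edgeOf G F a w p) | h | i
      ... | yes e∥f | _ | _ =
        f-cut (joins-uncut f-joins (sym (uncut-walk rest (onlyUncut noParallel hs))))
        where
        f-joins : Joins f a w
        f-joins = parallel-joins e∥f (edgeOf-joins a w p)
        z≢a : z ≢ a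
        z≢a = All.lookup z∉ (last∈verts r)
        noParallel : ¬ Any (Parallel f) (edges G F rest)
        noParallel (here e′∥f)
          with joins-endpoint f-joins (proj₂ (endpoint-joins (parallel-joins {f} e′∥f (edgeOf-joins w z q))))
        ... | inj₁ z≡a = z≢a z≡a
        ... | inj₂ z≡w = adj-irrefl q (sym z≡w)
        noParallel (there j) =
          All.lookup w∉ (parallel-endpoint∈verts {f} rest′ j (proj₂ (endpoint-joins f-joins))) refl
      ... | no ¬e∥f | inj₁ e∥f | _        = ¬e∥f e∥f
      ... | no ¬e∥f | inj₂ _   | here e∥f = ¬e∥f e∥f
      ... | no _    | inj₂ unc | there j  =
        cut-path rest uniqueRest hs j (sym (uncut-joins (edgeOf-joins a w p) unc))

    lifted-uncut : ∀ {e} → Uncut e → liftedMulticutVec G F π e ≡ 0ℚ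
    lifted-uncut {e} unc = cong (λ b → if b then 0ℚ else 1ℚ) (dec-true (uncut? e) unc)

    lifted-cut : ∀ {e} → ¬ Uncut e → liftedMulticutVec G F π e ≡ 1ℚ
    lifted-cut {e} cut = cong (λ b → if b then 0ℚ else 1ℚ) (dec-false (uncut? e) cut)

    module _ (y : Ê G F → ℚ) (y≡lifted : ∀ e → y e ≡ liftedMulticutVec G F π e) where

      y-uncut : ∀ {e} → Uncut e → y e ≡ 0ℚ
      y-uncut {e} unc = trans (y≡lifted e) (lifted-uncut {e} unc)

      y-cut : ∀ {e} → ¬ Uncut e → y e ≡ 1ℚ
      y-cut {e} cut = trans (y≡lifted e) (lifted-cut {e} cut)

      y-zeroOne : ∀ e → ZeroOne (y e)
      y-zeroOne e with uncut? e
      ... | yes unc = inj₁ (y-uncut unc)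
      ... | no  cut = inj₂ (y-cut cut)

      y-nonneg : ∀ e → 0ℚ ≤ℚ y e
      y-nonneg e = zeroOne-nonneg (y-zeroOne e)

      cycleIneqs : CycleIneqs G F y
      cycleIneqs a c isCycle f f∈c with uncut? f
      ... | yes unc = ℚ.≤-trans (ℚ.≤-reflexive (y-uncut unc)) (sumExcept-nonneg y-nonneg f (edges G F c))
      ... | no  cut = ℚ.≤-trans (ℚ.≤-reflexive (y-cut cut)) (sumExcept-≥1 y-nonneg f otherCutEdge)
        where
        parallelOrUncut? : Relation.Unary.Decidable (λ e → Parallel f e ⊎ Uncut e)
        parallelOrUncut? e = parallel? f e ⊎-dec uncut? e
        otherCutEdge : Any (λ e → ¬ Parallel f e × y e ≡ 1ℚ) (edges G F c)
        otherCutEdge with All.all? parallelOrUncut? (edges G F c)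
        ... | yes all  = ⊥-elim (cut-cycle f cut c isCycle all f∈c)
        ... | no  ¬all = Any.map (λ neither → neither ∘ inj₁ , y-cut (neither ∘ inj₂))
                                 (All.¬All⇒Any¬ parallelOrUncut? _ ¬all)

      ys-nonneg : ∀ es → All (0ℚ ≤ℚ_) (map y es)
      ys-nonneg es = All.map⁺ (All.universal y-nonneg es)

      pathIneqs : PathIneqs G F y
      pathIneqs u v lt fu P _ with uncut? ((u , v) , lt , inj₂ fu)
      ... | yes unc = ℚ.≤-trans (ℚ.≤-reflexive (y-uncut unc)) (sumℚ-nonneg (ys-nonneg (edges G F P)))
      ... | no  cut = ℚ.≤-trans (ℚ.≤-reflexive (y-cut cut))
                        (sumℚ-≥1 (ys-nonneg (edges G F P))
                                 (Any.map⁺ (Any.map (ℚ.≤-reflexive ∘ sym ∘ y-cut) cutEdge)))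
        where
        cutEdge : Any (¬_ ∘ Uncut) (edges G F P)
        cutEdge = All.¬All⇒Any¬ uncut? _ (cut ∘ uncut-walk P)

      cutIneqs : IsDecomposition G F π → CutIneqs G F y
      cutIneqs isDecomposition u v lt fu U (separates , _) with uncut? ((u , v) , lt , inj₂ fu)
      ... | no  cut = ℚ.≤-trans (ℚ.≤-reflexive (cong (1ℚ -_) (y-cut cut))) (cutSum-nonneg U y y-zeroOne)
      ... | yes unc with isDecomposition u v unc
      ...   | w , inBlock with crossing-edge U w inBlock (separates⇒≢ separates)
      ...     | a , b , p , Ua≢Ub , πa≡πu , πb≡πu =
        ℚ.≤-trans (ℚ.≤-reflexive (cong (1ℚ -_) (y-uncut unc)))
          (crossing-zero-edge⇒cutSum≥1 U y y-zeroOne p Ua≢Ub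
            (y-uncut (joins-uncut (edgeOf-joins a b p) (trans πa≡πu (sym πb≡πu)))))

      lifted-feasible : IsDecomposition G F π → IsFeasible01 G F y
      lifted-feasible isDecomposition = y-zeroOne , cycleIneqs , pathIneqs , cutIneqs isDecomposition

  module FeasibleIsLifted (connected : Connected G F) (x : Ê G F → ℚ) (feasible : IsFeasible01 G F x) where

    x-zeroOne : ∀ e → ZeroOne (x e)
    x-zeroOne = proj₁ feasible

    x-cycle : CycleIneqs G F x
    x-cycle = proj₁ (proj₂ feasible)

    x-path : PathIneqs G F x
    x-path = proj₁ (proj₂ (proj₂ feasible))

    x-cut : CutIneqs G F x
    x-cut = proj₂ (proj₂ (proj₂ feasible))

    ZeroEdge : Rel (Fin n) 0ℓ
    ZeroEdge y z = Σ (T (adj G y z)) λ p → x (edgeOf G F y z p) ≡ 0ℚ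

    zeroEdge? : Decidable ZeroEdge
    zeroEdge? y z with T? (adj G y z)
    ... | no ¬p = no (¬p ∘ proj₁)
    ... | yes p = map′ (p ,_) (λ (p′ , x≡0) → trans (cong x (edgeOf-irrelevant p p′)) x≡0)
                       (x (edgeOf G F y z p) ℚ.≟ 0ℚ)

    zeroEdge-sym : Symmetric ZeroEdge
    zeroEdge-sym (p , x≡0) = adj-sym′ p , trans (cong x (edgeOf-sym (adj-sym′ p) p)) x≡0

    open Representative zeroEdge? zeroEdge-sym renaming (representative to π)
    open LiftedMulticut π

    zeroWalk-edges : ∀ {u v} (w : Star ZeroEdge u v) → All (λ e → x e ≡ 0ℚ) (edges G F (toWalk proj₁ w))
    zeroWalk-edges ε               = []
    zeroWalk-edges ((_ , x≡0) ◅ w) = x≡0 ∷ zeroWalk-edges w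

    π-isDecomposition : IsDecomposition G F π
    π-isDecomposition u v πu≡πv =
      toWalk proj₁ w , subst (All _) (sym (verts-toWalk proj₁ w)) (All-vertices sameClass refl w)
      where
      w = representative≡⇒Star πu≡πv
      sameClass : ∀ {y z} → ZeroEdge y z → π y ≡ π u → π z ≡ π u
      sameClass e πy≡πu = trans (sym (Star⇒representative≡ (e ◅ ε))) πy≡πu

    zeroPath : ∀ {u v} → Star ZeroEdge u v →
               Σ (Walk G F u v) λ P → Unique (verts G F P) × All (λ e → x e ≡ 0ℚ) (edges G F P)
    zeroPath w with loopErase _≟ᶠ_ w
    ... | w′ , unique =
      toWalk proj₁ w′ , subst Unique (sym (verts-toWalk proj₁ w′)) unique , zeroWalk-edges w′

    -- A value-0 path between the ends of a G-edge of value 1 closes a cycle violating (1).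
    gEdge-one⇒cut : ∀ {a b} (lt : a < b) (p : T (adj G a b)) →
                  x ((a , b) , lt , inj₁ p) ≡ 1ℚ → ¬ Uncut ((a , b) , lt , inj₁ p)
    gEdge-one⇒cut {a} {b} lt p x≡1 πa≡πb with zeroPath (Star-sym (representative≡⇒Star πa≡πb))
    ... | [] , _ , _ = adj-irrefl p refl
    ... | step q [] , _ , x≡0 ∷ [] =
      1≰0 (ℚ.≤-reflexive
            (trans (sym x≡1) (trans (cong x (trans (sorted-edge≡edgeOf lt p) (edgeOf-sym p q))) x≡0)))
    ... | P@(step _ (step _ _)) , unique , zeros =
      1≰0 (ℚ.≤-trans (ℚ.≤-reflexive (sym x≡1))
            (ℚ.≤-trans (x-cycle a (step p P) isCycle e (here e∥e))
                       (ℚ.≤-reflexive (sumExcept-zero x e (inj₁ e∥e ∷ All.map inj₂ zeros)))))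
      where
      e = (a , b) , lt , inj₁ p
      e∥e : Parallel e (edgeOf G F a b p)
      e∥e = cong (ends G F) (sym (sorted-edge≡edgeOf lt p))
      isCycle : IsCycle G F (step p P)
      isCycle = subst Unique (sym (tailVerts-step p P)) unique , s≤s (s≤s (s≤s z≤n))

    fEdge-one⇒cut : ∀ {u v} (lt : u < v) (fu : T (F u v)) →
                   x ((u , v) , lt , inj₂ fu) ≡ 1ℚ → ¬ Uncut ((u , v) , lt , inj₂ fu)
    fEdge-one⇒cut {u} {v} lt fu x≡1 πu≡πv with zeroPath (representative≡⇒Star πu≡πv)
    ... | P , unique , zeros =
      1≰0 (ℚ.≤-trans (ℚ.≤-reflexive (sym x≡1))
            (ℚ.≤-trans (x-path u v lt fu P unique) (ℚ.≤-reflexive (sumℚ-zero (All.map⁺ zeros)))))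

    module SeparatingCut {u v} (lt : u < v) (fu : T (F u v)) (x≡0 : x ((u , v) , lt , inj₂ fu) ≡ 0ℚ)
                         (u≁v : ¬ Star ZeroEdge u v) where

      InC : Fin n → Set
      InC = Star ZeroEdge u

      OutsideC : Rel (Fin n) 0ℓ
      OutsideC y z = T (adj G y z) × ¬ InC y × ¬ InC z

      outsideC? : Decidable OutsideC
      outsideC? y z = T? (adj G y z) ×-dec ¬? (reachable? zeroEdge? u y) ×-dec ¬? (reachable? zeroEdge? u z)

      InW : Fin n → Set
      InW = Star OutsideC v

      inW? : Relation.Unary.Decidable InW
      inW? = reachable? outsideC? v

      U : Fin n → Bool
      U y = not (does (inW? y))

      inW⇒¬inC : ∀ {y} → InW y → ¬ InC y
      inW⇒¬inC = Star-preserves (λ e _ → proj₂ (proj₂ e)) u≁v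

      inW-closed : ∀ {y z} → InW y → T (adj G y z) → ¬ InC z → InW z
      inW-closed w p ¬Cz = w ◅◅ ((p , inW⇒¬inC w , ¬Cz) ◅ ε)

      U≡false : ∀ {y} → InW y → U y ≡ false
      U≡false {y} w = cong not (dec-true (inW? y) w)

      U≡true : ∀ {y} → ¬ InW y → U y ≡ true
      U≡true {y} ¬w = cong not (dec-false (inW? y) ¬w)

      ¬inW⇒U : ∀ {y} → ¬ InW y → T (U y)
      ¬inW⇒U ¬w = subst T (sym (U≡true ¬w)) _

      U⇒¬inW : ∀ {y} → T (U y) → ¬ InW y
      U⇒¬inW Uy w = subst T (U≡false w) Uy

      inW⇒¬U : ∀ {y} → InW y → T (not (U y))
      inW⇒¬U w = subst (T ∘ not) (sym (U≡false w)) _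

      ¬U⇒inW : ∀ {y} → T (not (U y)) → InW y
      ¬U⇒inW {y} ¬Uy = decidable-stable (inW? y) λ ¬w → subst (T ∘ not) (U≡true ¬w) ¬Uy

      -- Follow a walk to u until it enters C, then follow C; W is never entered.
      reachesU : ∀ {y} → Walk G F y u → ¬ InW y → Star (Within U) y u
      reachesU {y} r ¬w with reachable? zeroEdge? u y
      ... | yes c = Star.map (λ (e , Cy , Cz) → proj₁ e , inC⇒U Cy , inC⇒U Cz)
                             (restrict (λ e Cy → Cy ◅◅ (e ◅ ε)) c (Star-sym c))
        where inC⇒U : ∀ {z} → InC z → T (U z)
              inC⇒U Cz = ¬inW⇒U (λ w → inW⇒¬inC w Cz)
      reachesU {y} [] ¬w | no ¬c = ⊥-elim (¬c ε)
      reachesU {y} (step p r) ¬w | no ¬c = (p , ¬inW⇒U ¬w , ¬inW⇒U ¬w′) ◅ reachesU r ¬w′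
        where ¬w′ = λ w′ → ¬w (inW-closed w′ (adj-sym′ p) ¬c)

      reachesV : ∀ {y} → InW y → Star (Within (not ∘ U)) y v
      reachesV w = Star.reverse within-sym
        (Star.map (λ (e , wy , wz) → proj₁ e , inW⇒¬U wy , inW⇒¬U wz)
                  (restrict (λ e wy → wy ◅◅ (e ◅ ε)) ε w))

      isUVDecomposition : IsUVDecomposition G F U u v
      isUVDecomposition =
        inj₁ (¬inW⇒U (λ w → inW⇒¬inC w ε) , inW⇒¬U ε) ,
        hub⇒inducesConnected U u (λ y Uy → reachesU (connected y u) (U⇒¬inW Uy)) ,
        hub⇒inducesConnected (not ∘ U) v (λ y ¬Uy → reachesV (¬U⇒inW ¬Uy))

      leavingW-one : ∀ {s t} (p : T (adj G s t)) → InW s → ¬ InW t → x (edgeOf G F s t p) ≡ 1ℚ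
      leavingW-one {s} {t} p ws ¬wt with x-zeroOne (edgeOf G F s t p)
      ... | inj₂ x≡1 = x≡1
      ... | inj₁ x≡0 with reachable? zeroEdge? u t
      ...   | yes Ct = ⊥-elim (inW⇒¬inC ws (Ct ◅◅ (zeroEdge-sym (p , x≡0) ◅ ε)))
      ...   | no ¬Ct = ⊥-elim (¬wt (inW-closed ws p ¬Ct))

      crossing-one : ∀ {a b} (lt : a < b) (p : T (adj G a b)) → U a ≢ U b →
                     x ((a , b) , lt , inj₁ p) ≡ 1ℚ
      crossing-one {a} {b} lt p Ua≢Ub with inW? a | inW? b
      ... | yes wa | yes wb = ⊥-elim (Ua≢Ub (trans (U≡false wa) (sym (U≡false wb))))
      ... | no ¬wa | no ¬wb = ⊥-elim (Ua≢Ub (trans (U≡true ¬wa) (sym (U≡true ¬wb))))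
      ... | yes wa | no ¬wb = trans (cong x (sorted-edge≡edgeOf lt p)) (leavingW-one p wa ¬wb)
      ... | no ¬wa | yes wb =
        trans (cong x (trans (sorted-edge≡edgeOf lt p) (edgeOf-sym p (adj-sym′ p))))
              (leavingW-one (adj-sym′ p) wb ¬wa)

      cutSum≡0 : cutSum G F U x ≡ 0ℚ
      cutSum≡0 = cutSum-zero U x (λ a b → cutTerm-zero U x (crossing-one {a} {b}))

      cutIneq-violated : ⊥
      cutIneq-violated = 1≰0 (ℚ.≤-trans (ℚ.≤-reflexive (cong (1ℚ -_) (sym x≡0)))
                               (ℚ.≤-trans (x-cut u v lt fu U isUVDecomposition) (ℚ.≤-reflexive cutSum≡0)))

    zero⇒uncut : ∀ e → x e ≡ 0ℚ → Uncut e
    zero⇒uncut ((a , b) , lt , inj₁ p) x≡0 =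
      Star⇒representative≡ ((p , trans (cong x (sym (sorted-edge≡edgeOf lt p))) x≡0) ◅ ε)
    zero⇒uncut e@((u , v) , lt , inj₂ fu) x≡0 with uncut? e
    ... | yes unc = unc
    ... | no  cut = ⊥-elim (SeparatingCut.cutIneq-violated lt fu x≡0 (cut ∘ Star⇒representative≡))

    one⇒cut : ∀ e → x e ≡ 1ℚ → ¬ Uncut e
    one⇒cut ((a , b) , lt , inj₁ p)  = gEdge-one⇒cut lt p
    one⇒cut ((u , v) , lt , inj₂ fu) = fEdge-one⇒cut lt fu

    feasible-lifted : IsLiftedMulticutVec G F x
    feasible-lifted = π , π-isDecomposition , x≡lifted
      where
      x≡lifted : ∀ e → x e ≡ liftedMulticutVec G F π e
      x≡lifted e with x-zeroOne e
      ... | inj₁ x≡0 = trans x≡0 (sym (lifted-uncut {e} (zero⇒uncut e x≡0)))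
      ... | inj₂ x≡1 = trans x≡1 (sym (lifted-cut {e} (one⇒cut e x≡1)))

ConvHull-mono : ∀ {n} (G : SimpleGraph n) F {S S′ : (Ê G F → ℚ) → Set} →
                (∀ {y} → S y → S′ y) → ∀ {x} → ConvHull G F S x → ConvHull G F S′ x
ConvHull-mono G F S⊆S′ (cs , weighted , sum≡1 , x≡) =
  cs , All.map (λ (c≥0 , Sy) → c≥0 , S⊆S′ Sy) weighted , sum≡1 , x≡

proposition5p1 : (n : ℕ) (G : SimpleGraph n) (F : Fin n → Fin n → Bool)
                 → (∀ u v → F u v ≡ F v u) → (∀ u → F u u ≡ false)
                 → (∀ u v → T (F u v) → ¬ T (adj G u v))
                 → Connected G F
                 → (x : Ê G F → ℚ)
                 → LMC G F x ⇔ ConvHull G F (IsFeasible01 G F) x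
proposition5p1 n G F _ _ E∩F≡∅ connected x =
  mk⇔ (ConvHull-mono G F λ (π , isDecomposition , y≡lifted) →
         LiftedMulticut.lifted-feasible π _ y≡lifted isDecomposition)
      (ConvHull-mono G F (FeasibleIsLifted.feasible-lifted connected _))
  where open Graph G F E∩F≡∅
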